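{- Let $A$ be a cirquent with a subcirquent $B$, let $B'$ be a cirquent with $\overline{B'}<\overline{B}$, and let $A'$ be the result of replacing an occurrence of $B$ in $A$ by $B'$. Then $\overline{A'}<\overline{A}$.
   Context: Cirquents are built inductively: $\top$, $\bot$ and literals ($p$ or $\neg p$ for an elementary letter $p$) are cirquents; if $A,B$ are cirquents then so are $A\vee B$, $A\wedge B$, $A\sqcap^c B$ ($c$ a conjunctive cluster) and $A\sqcup^c B$ ($c$ a disjunctive cluster), where the conjunctive and disjunctive clusters form two fixed disjoint infinite sets. Tetration: ${}^1a=a$, ${}^{n+1}a=a^{({}^na)}$. The rank $\overline{C}$ of a cirquent: $\overline{C}=1$ if $C$ is $\top$, $\bot$ or a literal; $\overline{A\sqcup^cB}=\overline{A\sqcap^cB}=\overline{A}+\overline{B}$; $\overline{A\wedge B}=5^{\overline{A}+\overline{B}}$; $\overline{A\vee B}={}^{(\overline{A}+\overline{B})}5$. -}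

module Defs where

open import Data.Nat using (ℕ; zero; suc; _+_; _^_)

-- Elementary letters and clusters are indexed by ℕ; conjunctive and
-- disjunctive clusters are kept disjoint by using separate constructors.
Letter : Set
Letter = ℕ

ConjCluster : Set
ConjCluster = ℕ

DisjCluster : Set
DisjCluster = ℕ

data Cirquent : Set where
  ⊤c ⊥c   : Cirquent
  pos neg : Letter → Cirquent
  _∨c_ _∧c_ : Cirquent → Cirquent → Cirquent
  ⊓[_]    : ConjCluster → Cirquent → Cirquent → Cirquent
  ⊔[_]    : DisjCluster → Cirquent → Cirquent → Cirquent

-- Tetration with base a: ^1 a = a, ^(n+1) a = a^(^n a).
-- (The value at 0 is set to 1 by convention; it is never used by rank
-- since all ranks are ≥ 1, so arguments of tetration are ≥ 2.)
tet : ℕ → ℕ → ℕ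
tet a zero          = 1
tet a (suc zero)    = a
tet a (suc (suc n)) = a ^ tet a (suc n)

rank : Cirquent → ℕ
rank ⊤c          = 1
rank ⊥c          = 1
rank (pos _)     = 1
rank (neg _)     = 1
rank (⊓[ c ] A B) = rank A + rank B
rank (⊔[ c ] A B) = rank A + rank B
rank (A ∧c B)    = 5 ^ (rank A + rank B)
rank (A ∨c B)    = tet 5 (rank A + rank B)

-- One-hole contexts: an occurrence of a subcirquent in a cirquent.
data Context : Set where
  hole   : Context
  ∨L ∧L  : Context → Cirquent → Context
  ∨R ∧R  : Cirquent → Context → Context
  ⊓L     : ConjCluster → Context → Cirquent → Context
  ⊓R     : ConjCluster → Cirquent → Context → Context
  ⊔L     : DisjCluster → Context → Cirquent → Context
  ⊔R     : DisjCluster → Cirquent → Context → Context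

plug : Context → Cirquent → Cirquent
plug hole         X = X
plug (∨L K C) X = plug K X ∨c C
plug (∧L K C) X = plug K X ∧c C
plug (∨R C K) X = C ∨c plug K X
plug (∧R C K) X = C ∧c plug K X
plug (⊓L c K C) X = ⊓[ c ] (plug K X) C
plug (⊓R c C K) X = ⊓[ c ] C (plug K X)
plug (⊔L c K C) X = ⊔[ c ] (plug K X) C
plug (⊔R c C K) X = ⊔[ c ] C (plug K X)

module Submission where

open import Defs
open import Data.Nat using (ℕ; zero; suc; _+_; _^_; _<_; s≤s; z≤n)
open import Data.Nat.Properties
open import Data.Sum using (inj₁; inj₂)
open import Relation.Binary.PropositionalEquality using (refl; subst)

step-<⇒mono-< : (f : ℕ → ℕ) → (∀ n → f n < f (suc n)) →
                ∀ {m n} → m < n → f m < f n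
step-<⇒mono-< f step {m} {suc n} m<1+n with m<1+n⇒m<n∨m≡n m<1+n
... | inj₁ m<n  = <-trans (step-<⇒mono-< f step m<n) (step n)
... | inj₂ refl = step n

tet-step-< : ∀ {a} → 1 < a → ∀ n → tet a n < tet a (suc n)
tet-step-< 1<a zero          = 1<a
tet-step-< {a} 1<a (suc zero) =
  subst (_< a ^ a) (^-identityʳ a) (^-monoʳ-< a 1<a 1<a)
tet-step-< {a} 1<a (suc (suc n)) = ^-monoʳ-< a 1<a (tet-step-< 1<a (suc n))

tet-monoʳ-< : ∀ {a} → 1 < a → ∀ {m n} → m < n → tet a m < tet a n
tet-monoʳ-< {a} 1<a = step-<⇒mono-< (tet a) (tet-step-< 1<a)

1<5 : 1 < 5
1<5 = s≤s (s≤s z≤n)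

lemma7p2 : (K : Context) (B B′ : Cirquent) →
    rank B′ < rank B → rank (plug K B′) < rank (plug K B)
lemma7p2 hole       B B′ h = h
lemma7p2 (∨L K C)   B B′ h = tet-monoʳ-< 1<5 (+-monoˡ-< (rank C) (lemma7p2 K B B′ h))
lemma7p2 (∨R C K)   B B′ h = tet-monoʳ-< 1<5 (+-monoʳ-< (rank C) (lemma7p2 K B B′ h))
lemma7p2 (∧L K C)   B B′ h = ^-monoʳ-< 5 1<5 (+-monoˡ-< (rank C) (lemma7p2 K B B′ h))
lemma7p2 (∧R C K)   B B′ h = ^-monoʳ-< 5 1<5 (+-monoʳ-< (rank C) (lemma7p2 K B B′ h))
lemma7p2 (⊓L c K C) B B′ h = +-monoˡ-< (rank C) (lemma7p2 K B B′ h)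
lemma7p2 (⊓R c C K) B B′ h = +-monoʳ-< (rank C) (lemma7p2 K B B′ h)
lemma7p2 (⊔L c K C) B B′ h = +-monoˡ-< (rank C) (lemma7p2 K B B′ h)
lemma7p2 (⊔R c C K) B B′ h = +-monoʳ-< (rank C) (lemma7p2 K B B′ h)
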